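{- Let $p>5$ be a prime. For $1\le a\le 4$ let $C_a$ be the number of tuples $(x_1,\dots,x_5)$ of nonnegative integers with $x_1+\cdots+x_5=2p-a$ and $0\le x_i<p$ for $1\le i\le 5$. Then (i) $C_a=\binom{2p-a+4}{4}-5\binom{p-a+4}{4}$; (ii) $C_1\equiv -\frac34 p$, $C_2\equiv \frac14 p$, $C_3\equiv -\frac14 p$, $C_4\equiv \frac34 p \pmod{p^2}$; (iii) $\sum x_1\equiv 0\pmod p$, where the sum is over all tuples $(x_1,\dots,x_5)$ of integers with $x_1+\cdots+x_5=2p-a$ and $0\le x_i<p$ for $1\le i\le 5$.
   Context: Congruences are in the ring of rationals whose denominators are prime to $p$. -}

module Defs where

open import Data.Nat using (ℕ; zero; suc; _+_; _*_; _^_; _∸_)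
open import Data.Nat.Properties using (_≟_)
open import Data.Nat.Coprimality using (Coprime)
open import Data.List using (List; []; _∷_; [_]; map; concatMap; upTo; filter)
open import Data.Vec using (Vec) renaming ([] to []ᵥ; _∷_ to _∷ᵥ_; sum to sumᵥ)
open import Data.Integer using (ℤ; +_)
open import Data.Rational as ℚ using (ℚ; _-_; _/_)
open import Data.Product using (Σ; _×_)
open import Relation.Binary.PropositionalEquality using (_≡_)

allTuples : (k p : ℕ) → List (Vec ℕ k)
allTuples zero    p = [ []ᵥ ]
allTuples (suc k) p = concatMap (λ x → map (x ∷ᵥ_) (allTuples k p)) (upTo p)

tuples5 : (p n : ℕ) → List (Vec ℕ 5)
tuples5 p n = filter (λ v → sumᵥ v ≟ n) (allTuples 5 p)

ℕ→ℚ : ℕ → ℚ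
ℕ→ℚ n = (+ n) / 1

-- Congruence modulo p^k in the ring ℤ_(p) of rationals whose denominator
-- is prime to p:  x ≡ y (mod p^k)  iff  x - y = p^k · r  with r ∈ ℤ_(p).
CongModPow : (p k : ℕ) → ℚ → ℚ → Set
CongModPow p k x y =
  Σ ℚ (λ r → Coprime (ℚ.denominatorℕ r) p × (x - y ≡ ℕ→ℚ (p ^ k) ℚ.* r))

{-# OPTIONS --safe #-}
module Submission where

-- By inclusion–exclusion the 5-tuples in [0,p)⁵ with sum n < 2p number C(n+4,4) − 5·C(n−p+4,4), since
-- at most one coordinate can reach p. With R(x) = (x+1)(x+2)(x+3)(x+4) = 24·C(x+4,4) this gives
-- 24·C_a = R(2p−a) − 5·R(p−a), a polynomial in p whose constant term −4·R(−a) vanishes for 1 ≤ a ≤ 4;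
-- its linear coefficient 6·s(a) yields C_a ≡ (s(a)/4)·p (mod p²), in particular p ∣ C_a. As the
-- coordinates are symmetric, n·C_a = 5·Σ x₁, so p ∣ Σ x₁ as well.

open import Defs
open import Data.Bool using (true; false; if_then_else_)
open import Data.List using (List; []; _∷_; _++_; length; map; concatMap; applyUpTo; upTo; filter)
open import Data.List.Properties using (filter-++; filter-≐; length-++; length-map; map-∘; concatMap-cong; map-concatMap)
open import Data.Nat as ℕ using (ℕ; zero; suc; _+_; _*_; _∸_; _≤_; _<_; _≤?_; _<?_; z≤n; s≤s; _^_)
open import Data.Nat.Properties
open import Data.Nat.Coprimality using (Coprime)
open import Data.Nat.Divisibility using (_∣_; divides; ∣⇒≤; ∣-trans; ∣n⇒∣m*n)
open import Data.Nat.GCD using (gcd)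
open import Data.Nat.Primality using (Prime; euclidsLemma; prime⇒irreducible)
open import Data.Nat.Combinatorics using (_C_; nCn≡1; nC1≡n; nCk+nC[k+1]≡[n+1]C[k+1])
open import Data.Nat.ListAction using (sum)
open import Data.Nat.ListAction.Properties using (sum-++)
open import Data.Nat.Tactic.RingSolver using (solve-∀)
open import Data.Vec using (Vec; head) renaming (_∷_ to _∷ᵥ_; sum to sumᵥ)
open import Data.Product using (_×_; _,_)
open import Data.Sum using (inj₁; inj₂; [_,_]′)
open import Function using (_∘_; id; mk⇔)
open import Level using (Level)
open import Relation.Nullary using (Dec; yes; no; does; ¬_)
open import Relation.Nullary.Decidable using (does-⇔; dec-true; dec-false)
open import Relation.Nullary.Negation using (contradiction)
open import Relation.Unary using (Pred; Decidable; _≐_)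
open import Relation.Binary.PropositionalEquality

private variable
  ℓ : Level
  A B : Set

∑< : ℕ → (ℕ → ℕ) → ℕ
∑< zero    f = 0
∑< (suc q) f = f 0 + ∑< q (f ∘ suc)

infix 5 ∑<
syntax ∑< q (λ x → e) = ∑[ x < q ] e

∑<-cong : ∀ q {f g : ℕ → ℕ} → (∀ x → x < q → f x ≡ g x) → ∑< q f ≡ ∑< q g
∑<-cong zero    f≡g = refl
∑<-cong (suc q) f≡g = cong₂ _+_ (f≡g 0 (s≤s z≤n)) (∑<-cong q (λ x x<q → f≡g (suc x) (s≤s x<q)))

∑<-0 : ∀ q → ∑[ _ < q ] 0 ≡ 0
∑<-0 zero    = refl
∑<-0 (suc q) = ∑<-0 q

∑<-single : ∀ {q f} → 0 < q → (∀ x → 0 < x → f x ≡ 0) → ∑< q f ≡ f 0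
∑<-single {suc q} {f} _ f≡0 =
  trans (cong (f 0 +_) (trans (∑<-cong q (λ x _ → f≡0 (suc x) (s≤s z≤n))) (∑<-0 q))) (+-identityʳ (f 0))

∑<-suc : ∀ q f → ∑< (suc q) f ≡ ∑< q f + f q
∑<-suc zero    f = +-comm (f 0) 0
∑<-suc (suc q) f = trans (cong (f 0 +_) (∑<-suc q (f ∘ suc))) (sym (+-assoc (f 0) _ _))

∑<-split : ∀ q d f → ∑< (q + d) f ≡ ∑< q f + (∑[ x < d ] f (q + x))
∑<-split zero    d f = refl
∑<-split (suc q) d f = trans (cong (f 0 +_) (∑<-split q d (f ∘ suc))) (sym (+-assoc (f 0) _ _))

∑<-+ : ∀ q f g → ∑[ x < q ] (f x + g x) ≡ ∑< q f + ∑< q g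
∑<-+ zero    f g = refl
∑<-+ (suc q) f g = trans (cong (f 0 + g 0 +_) (∑<-+ q (f ∘ suc) (g ∘ suc))) (+-+-swap (f 0) (g 0) _ _)
  where
  +-+-swap : ∀ a b c d → a + b + (c + d) ≡ a + c + (b + d)
  +-+-swap = solve-∀

∑<-*ˡ : ∀ q c f → c * ∑< q f ≡ ∑[ x < q ] (c * f x)
∑<-*ˡ zero    c f = *-zeroʳ c
∑<-*ˡ (suc q) c f = trans (*-distribˡ-+ c (f 0) _) (cong (c * f 0 +_) (∑<-*ˡ q c (f ∘ suc)))

∑<-comm : ∀ q r (f : ℕ → ℕ → ℕ) → ∑[ x < q ] ∑[ y < r ] f x y ≡ ∑[ y < r ] ∑[ x < q ] f x y
∑<-comm zero    r f = sym (∑<-0 r)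
∑<-comm (suc q) r f =
  trans (cong (∑< r (f 0) +_) (∑<-comm q r (f ∘ suc))) (sym (∑<-+ r (f 0) (λ y → ∑[ x < q ] f (suc x) y)))

sum-map-applyUpTo : ∀ (f g : ℕ → ℕ) q → sum (map f (applyUpTo g q)) ≡ ∑< q (f ∘ g)
sum-map-applyUpTo f g zero    = refl
sum-map-applyUpTo f g (suc q) = cong (f (g 0) +_) (sum-map-applyUpTo f (g ∘ suc) q)

module _ {P : Pred B ℓ} (P? : Decidable P) where

  filter-concatMap : ∀ (F : A → List B) xs → filter P? (concatMap F xs) ≡ concatMap (filter P? ∘ F) xs
  filter-concatMap F []       = refl
  filter-concatMap F (x ∷ xs) = trans (filter-++ P? (F x) _) (cong (filter P? (F x) ++_) (filter-concatMap F xs))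

  filter-map : ∀ (f : A → B) xs → filter P? (map f xs) ≡ map f (filter (P? ∘ f) xs)
  filter-map f []       = refl
  filter-map f (x ∷ xs) with does (P? (f x))
  ... | true  = cong (f x ∷_) (filter-map f xs)
  ... | false = filter-map f xs

length-concatMap : ∀ (F : A → List B) xs → length (concatMap F xs) ≡ sum (map (length ∘ F) xs)
length-concatMap F []       = refl
length-concatMap F (x ∷ xs) = trans (length-++ (F x)) (cong (length (F x) +_) (length-concatMap F xs))

sum-concatMap : ∀ (F : A → List ℕ) xs → sum (concatMap F xs) ≡ sum (map (sum ∘ F) xs)
sum-concatMap F []       = refl
sum-concatMap F (x ∷ xs) = trans (sum-++ (F x) _) (cong (sum (F x) +_) (sum-concatMap F xs))

sum-map-const : ∀ (c : ℕ) (xs : List A) → sum (map (λ _ → c) xs) ≡ c * length xs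
sum-map-const c []       = sym (*-zeroʳ c)
sum-map-const c (x ∷ xs) = trans (cong (c +_) (sum-map-const c xs)) (sym (*-suc c (length xs)))

-- Summation by parts without subtraction: if g (suc j) = (F − G) (suc j) − (F − G) j for j < n, then
-- a window of q values of g ending at n sums to (F − G) n − (F − G) (n − q).
telescope : ∀ (g F G : ℕ → ℕ) n →
  (∀ j → suc j ≤ n → g (suc j) + F j + G (suc j) ≡ F (suc j) + G j) →
  ∀ q → q ≤ n → (∑[ x < q ] g (n ∸ x)) + F (n ∸ q) + G n ≡ F n + G (n ∸ q)
telescope g F G n Δ zero    _   = refl
telescope g F G n Δ (suc q) q<n = +-cancelʳ-≡ (F (suc j) + G (suc j)) _ _ (begin
  (∑[ x < suc q ] g (n ∸ x)) + F j + G n + (F (suc j) + G (suc j))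
    ≡⟨ cong (λ s → s + F j + G n + (F (suc j) + G (suc j))) (∑<-suc q (λ x → g (n ∸ x))) ⟩
  S + g (n ∸ q) + F j + G n + (F (suc j) + G (suc j))
    ≡⟨ cong (λ m → S + g m + F j + G n + (F (suc j) + G (suc j))) n∸q≡1+j ⟩
  S + g (suc j) + F j + G n + (F (suc j) + G (suc j))
    ≡⟨ regroup S (g (suc j)) (F j) (G n) (F (suc j)) (G (suc j)) ⟩
  (S + F (suc j) + G n) + (g (suc j) + F j + G (suc j))
    ≡⟨ cong₂ _+_ previous (Δ j (subst (_≤ n) n∸q≡1+j (m∸n≤m n q))) ⟩
  (F n + G (suc j)) + (F (suc j) + G j)
    ≡⟨ regroup′ (F n) (G (suc j)) (F (suc j)) (G j) ⟩
  F n + G j + (F (suc j) + G (suc j)) ∎)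
  where
  open ≡-Reasoning
  S j : ℕ
  S = ∑[ x < q ] g (n ∸ x)
  j = n ∸ suc q
  n∸q≡1+j : n ∸ q ≡ suc j
  n∸q≡1+j = +-∸-assoc 1 q<n
  previous : S + F (suc j) + G n ≡ F n + G (suc j)
  previous = subst (λ m → S + F m + G n ≡ F n + G m) n∸q≡1+j (telescope g F G n Δ q (<⇒≤ q<n))
  regroup : ∀ s a b c d e → s + a + b + c + (d + e) ≡ (s + d + c) + (a + b + e)
  regroup = solve-∀
  regroup′ : ∀ a b c d → (a + b) + (c + d) ≡ a + d + (c + b)
  regroup′ = solve-∀

∸-*-split : ∀ x y n c → (n < x + y → c ≡ 0) → (n ∸ x) * c ≡ y * c + (n ∸ (x + y)) * c
∸-*-split x y n c c≡0 with x + y ≤? n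
... | yes x+y≤n = begin
  (n ∸ x) * c                    ≡⟨ cong (_* c) (sym (m+[n∸m]≡n y≤n∸x)) ⟩
  (y + (n ∸ x ∸ y)) * c          ≡⟨ cong (λ w → (y + w) * c) (∸-+-assoc n x y) ⟩
  (y + (n ∸ (x + y))) * c        ≡⟨ *-distribʳ-+ c y (n ∸ (x + y)) ⟩
  y * c + (n ∸ (x + y)) * c      ∎
  where
  open ≡-Reasoning
  y≤n∸x : y ≤ n ∸ x
  y≤n∸x = m+n≤o⇒m≤o∸n y (subst (_≤ n) (+-comm x y) x+y≤n)
... | no x+y≰n rewrite c≡0 (≰⇒> x+y≰n) =
  trans (*-zeroʳ (n ∸ x)) (sym (cong₂ _+_ (*-zeroʳ y) (*-zeroʳ (n ∸ (x + y)))))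

module _ (p : ℕ) where

  countWith : ℕ → ℕ → ℕ → ℕ
  countWith zero    x n = if does (x ≟ n) then 1 else 0
  countWith (suc k) x n = ∑[ y < p ] countWith k (x + y) n

  count : ℕ → ℕ → ℕ
  count k = countWith k 0

  firstSumWith : ℕ → ℕ → ℕ → ℕ
  firstSumWith zero    x n = 0
  firstSumWith (suc k) x n = ∑[ y < p ] y * countWith k (x + y) n

  tuplesWith : ∀ k → ℕ → ℕ → List (Vec ℕ k)
  tuplesWith k x n = filter (λ v → x + sumᵥ v ≟ n) (allTuples k p)

  tuplesWith-suc : ∀ k x n →
    tuplesWith (suc k) x n ≡ concatMap (λ y → map (y ∷ᵥ_) (tuplesWith k (x + y) n)) (upTo p)
  tuplesWith-suc k x n =
    trans (filter-concatMap _ _ (upTo p)) (concatMap-cong (λ y →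
      trans (filter-map _ (y ∷ᵥ_) (allTuples k p))
            (cong (map (y ∷ᵥ_)) (filter-≐ _ _ (reassociate y) (allTuples k p)))) (upTo p))
    where
    reassociate : ∀ y → (λ v → x + (y + sumᵥ v) ≡ n) ≐ (λ v → x + y + sumᵥ v ≡ n)
    reassociate y = trans (+-assoc x y _) , trans (sym (+-assoc x y _))

  length-tuplesWith : ∀ k x n → length (tuplesWith k x n) ≡ countWith k x n
  length-tuplesWith zero    x n rewrite +-identityʳ x with does (x ≟ n)
  ... | true  = refl
  ... | false = refl
  length-tuplesWith (suc k) x n = begin
    length (tuplesWith (suc k) x n)
      ≡⟨ cong length (tuplesWith-suc k x n) ⟩
    length (concatMap (λ y → map (y ∷ᵥ_) (tuplesWith k (x + y) n)) (upTo p))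
      ≡⟨ length-concatMap _ (upTo p) ⟩
    sum (map (λ y → length (map (y ∷ᵥ_) (tuplesWith k (x + y) n))) (upTo p))
      ≡⟨ sum-map-applyUpTo _ id p ⟩
    ∑[ y < p ] length (map (y ∷ᵥ_) (tuplesWith k (x + y) n))
      ≡⟨ ∑<-cong p (λ y _ → trans (length-map _ (tuplesWith k (x + y) n)) (length-tuplesWith k (x + y) n)) ⟩
    countWith (suc k) x n ∎
    where open ≡-Reasoning

  sum-head-tuplesWith : ∀ k x n → sum (map head (tuplesWith (suc k) x n)) ≡ firstSumWith (suc k) x n
  sum-head-tuplesWith k x n = begin
    sum (map head (tuplesWith (suc k) x n))
      ≡⟨ cong (sum ∘ map head) (tuplesWith-suc k x n) ⟩
    sum (map head (concatMap (λ y → map (y ∷ᵥ_) (tuplesWith k (x + y) n)) (upTo p)))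
      ≡⟨ cong sum (map-concatMap head _ (upTo p)) ⟩
    sum (concatMap (λ y → map head (map (y ∷ᵥ_) (tuplesWith k (x + y) n))) (upTo p))
      ≡⟨ sum-concatMap _ (upTo p) ⟩
    sum (map (λ y → sum (map head (map (y ∷ᵥ_) (tuplesWith k (x + y) n)))) (upTo p))
      ≡⟨ sum-map-applyUpTo _ id p ⟩
    ∑[ y < p ] sum (map head (map (y ∷ᵥ_) (tuplesWith k (x + y) n)))
      ≡⟨ ∑<-cong p (λ y _ → sum-heads y) ⟩
    firstSumWith (suc k) x n ∎
    where
    open ≡-Reasoning
    sum-heads : ∀ y → sum (map head (map (y ∷ᵥ_) (tuplesWith k (x + y) n))) ≡ y * countWith k (x + y) n
    sum-heads y = trans (cong sum (sym (map-∘ vs))) (trans (sum-map-const y vs) (cong (y *_) (length-tuplesWith k (x + y) n)))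
      where
      vs : List (Vec ℕ k)
      vs = tuplesWith k (x + y) n

  countWith-beyond : ∀ k {x n} → n < x → countWith k x n ≡ 0
  countWith-beyond zero    {x} {n} n<x rewrite dec-false (x ≟ n) (>⇒≢ n<x) = refl
  countWith-beyond (suc k) {x} {n} n<x = trans
    (∑<-cong p (λ y _ → countWith-beyond k (<-≤-trans n<x (m≤m+n x y))))
    (∑<-0 p)

  countWith-shift : ∀ k {x} y {n} → x ≤ n → countWith k (x + y) n ≡ countWith k y (n ∸ x)
  countWith-shift zero    {x} y {n} x≤n =
    cong (λ b → if b then 1 else 0) (does-⇔ (mk⇔ to from) (x + y ≟ n) (y ≟ n ∸ x))
    where
    to : x + y ≡ n → y ≡ n ∸ x
    to e = trans (sym (m+n∸m≡n x y)) (cong (_∸ x) e)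
    from : y ≡ n ∸ x → x + y ≡ n
    from e = trans (cong (x +_) e) (m+[n∸m]≡n x≤n)
  countWith-shift (suc k) {x} y {n} x≤n = ∑<-cong p (λ z _ →
    trans (cong (λ w → countWith k w n) (+-assoc x y z)) (countWith-shift k (y + z) x≤n))

  countWith≡count : ∀ k {x n} → x ≤ n → countWith k x n ≡ count k (n ∸ x)
  countWith≡count k {x} x≤n = trans (cong (λ w → countWith k w _) (sym (+-identityʳ x))) (countWith-shift k 0 x≤n)

  ∑-firstSumWith : ∀ k x n → k * (∑[ y < p ] firstSumWith k (x + y) n) ≡ k * firstSumWith (suc k) x n
  ∑-firstSumWith zero    x n = refl
  ∑-firstSumWith (suc k) x n = cong (suc k *_) (begin
    ∑[ y < p ] ∑[ z < p ] z * countWith k (x + y + z) n   ≡⟨ ∑<-comm p p _ ⟩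
    ∑[ z < p ] ∑[ y < p ] z * countWith k (x + y + z) n   ≡⟨ ∑<-cong p (λ z _ → ∑<-cong p (λ y _ →
                                                              cong (λ w → z * countWith k w n) (+-right-comm x y z))) ⟩
    ∑[ z < p ] ∑[ y < p ] z * countWith k (x + z + y) n   ≡⟨ ∑<-cong p (λ z _ → sym (∑<-*ˡ p z _)) ⟩
    firstSumWith (suc (suc k)) x n                          ∎)
    where
    open ≡-Reasoning
    +-right-comm : ∀ a b c → a + b + c ≡ a + c + b
    +-right-comm = solve-∀

  -- At x = 0 this reads n · #tuples = k · Σ x₁: by symmetry each coordinate contributes equally to Σ n.
  ∸-*-countWith : ∀ k x n → (n ∸ x) * countWith k x n ≡ k * firstSumWith k x n
  ∸-*-countWith zero    x n with x ≟ n
  ... | yes refl rewrite dec-true (x ≟ x) refl = cong (_* 1) (n∸n≡0 x)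
  ... | no x≢n   rewrite dec-false (x ≟ n) x≢n = *-zeroʳ (n ∸ x)
  ∸-*-countWith (suc k) x n = begin
    (n ∸ x) * countWith (suc k) x n
      ≡⟨ ∑<-*ˡ p (n ∸ x) _ ⟩
    ∑[ y < p ] (n ∸ x) * countWith k (x + y) n
      ≡⟨ ∑<-cong p (λ y _ → ∸-*-split x y n _ (countWith-beyond k)) ⟩
    ∑[ y < p ] (y * countWith k (x + y) n + (n ∸ (x + y)) * countWith k (x + y) n)
      ≡⟨ ∑<-+ p _ _ ⟩
    firstSumWith (suc k) x n + (∑[ y < p ] (n ∸ (x + y)) * countWith k (x + y) n)
      ≡⟨ cong (firstSumWith (suc k) x n +_) (∑<-cong p (λ y _ → ∸-*-countWith k (x + y) n)) ⟩
    firstSumWith (suc k) x n + (∑[ y < p ] k * firstSumWith k (x + y) n)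
      ≡⟨ cong (firstSumWith (suc k) x n +_) (trans (sym (∑<-*ˡ p k _)) (∑-firstSumWith k x n)) ⟩
    suc k * firstSumWith (suc k) x n ∎
    where open ≡-Reasoning

  -- The number of (k+1)-tuples of naturals with sum j whose first entry is at least p.
  overflow : ℕ → ℕ → ℕ
  overflow k j with p ≤? j
  ... | yes _ = (j ∸ p + k) C k
  ... | no  _ = 0

  overflow-≥ : ∀ k {j} → p ≤ j → overflow k j ≡ (j ∸ p + k) C k
  overflow-≥ k {j} p≤j with p ≤? j
  ... | yes _   = refl
  ... | no  p≰j = contradiction p≤j p≰j

  overflow-< : ∀ k {j} → j < p → overflow k j ≡ 0
  overflow-< k {j} j<p with p ≤? j
  ... | yes p≤j = contradiction p≤j (<⇒≱ j<p)
  ... | no  _   = refl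

  overflow-pascal : ∀ k j → overflow (suc k) (suc j) ≡ overflow (suc k) j + overflow k (suc j)
  overflow-pascal k j = by-cases (p ≤? j) (p ≤? suc j)
    where
    by-cases : Dec (p ≤ j) → Dec (p ≤ suc j) → overflow (suc k) (suc j) ≡ overflow (suc k) j + overflow k (suc j)
    by-cases (yes p≤j) _ = begin
      overflow (suc k) (suc j)                   ≡⟨ overflow-≥ (suc k) (m≤n⇒m≤1+n p≤j) ⟩
      (suc j ∸ p + suc k) C suc k                ≡⟨ cong (λ m → (m + suc k) C suc k) 1+j∸p ⟩
      suc r C suc k                              ≡⟨ sym (nCk+nC[k+1]≡[n+1]C[k+1] r k) ⟩
      r C k + r C suc k                          ≡⟨ +-comm (r C k) (r C suc k) ⟩
      r C suc k + r C k                          ≡⟨ cong₂ _+_ (sym (overflow-≥ (suc k) p≤j)) (cong (_C k) r≡) ⟩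
      overflow (suc k) j + (suc j ∸ p + k) C k   ≡⟨ cong (overflow (suc k) j +_) (sym (overflow-≥ k (m≤n⇒m≤1+n p≤j))) ⟩
      overflow (suc k) j + overflow k (suc j)    ∎
      where
      open ≡-Reasoning
      r : ℕ
      r = j ∸ p + suc k
      1+j∸p : suc j ∸ p ≡ suc (j ∸ p)
      1+j∸p = +-∸-assoc 1 p≤j
      r≡ : r ≡ suc j ∸ p + k
      r≡ = trans (+-suc (j ∸ p) k) (cong (_+ k) (sym 1+j∸p))
    by-cases (no p≰j) (yes p≤1+j) = begin
      overflow (suc k) (suc j)                   ≡⟨ overflow-≥ (suc k) p≤1+j ⟩
      (suc j ∸ p + suc k) C suc k                ≡⟨ cong (λ m → (m + suc k) C suc k) 1+j∸p≡0 ⟩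
      suc k C suc k                              ≡⟨ trans (nCn≡1 (suc k)) (sym (nCn≡1 k)) ⟩
      k C k                                      ≡⟨ cong (λ m → (m + k) C k) (sym 1+j∸p≡0) ⟩
      (suc j ∸ p + k) C k                        ≡⟨ sym (overflow-≥ k p≤1+j) ⟩
      overflow k (suc j)                         ≡⟨ cong (_+ overflow k (suc j)) (sym (overflow-< (suc k) (≰⇒> p≰j))) ⟩
      overflow (suc k) j + overflow k (suc j)    ∎
      where
      open ≡-Reasoning
      1+j∸p≡0 : suc j ∸ p ≡ 0
      1+j∸p≡0 = m≤n⇒m∸n≡0 (≰⇒> p≰j)
    by-cases (no p≰j) (no p≰1+j) = trans (overflow-< (suc k) (≰⇒> p≰1+j))
      (sym (cong₂ _+_ (overflow-< (suc k) (≰⇒> p≰j)) (overflow-< k (≰⇒> p≰1+j))))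

  -- Below 2p at most one coordinate can reach p, so inclusion–exclusion stops after the first correction.
  InclusionExclusion : ℕ → Set
  InclusionExclusion k = ∀ n → n < p + p → count (suc k) n + suc k * overflow k n ≡ (n + k) C k

  -- The first difference in n of InclusionExclusion (k − 1), stated without subtraction: this is what
  -- makes the window sum defining count (suc k) telescope.
  ΔInclusionExclusion : ℕ → Set
  ΔInclusionExclusion k = ∀ j → suc j < p + p →
    count k (suc j) + (j + k) C k + k * overflow k (suc j) ≡ (suc j + k) C k + k * overflow k j

  ΔInclusionExclusion-zero : ΔInclusionExclusion 0
  ΔInclusionExclusion-zero j _ = refl

  ΔInclusionExclusion-suc : ∀ k → InclusionExclusion k → ΔInclusionExclusion (suc k)
  ΔInclusionExclusion-suc k ie j 1+j<2p = begin
    count (suc k) (suc j) + (j + suc k) C suc k + suc k * overflow (suc k) (suc j)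
      ≡⟨ cong (λ m → count (suc k) (suc j) + (j + suc k) C suc k + suc k * m) (overflow-pascal k j) ⟩
    count (suc k) (suc j) + (j + suc k) C suc k + suc k * (overflow (suc k) j + overflow k (suc j))
      ≡⟨ regroup (count (suc k) (suc j)) ((j + suc k) C suc k) (suc k) (overflow (suc k) j) (overflow k (suc j)) ⟩
    (count (suc k) (suc j) + suc k * overflow k (suc j)) + (j + suc k) C suc k + suc k * overflow (suc k) j
      ≡⟨ cong (λ m → m + (j + suc k) C suc k + suc k * overflow (suc k) j) (ie (suc j) 1+j<2p) ⟩
    (suc j + k) C k + (j + suc k) C suc k + suc k * overflow (suc k) j
      ≡⟨ cong (λ m → m C k + (j + suc k) C suc k + suc k * overflow (suc k) j) (sym (+-suc j k)) ⟩
    (j + suc k) C k + (j + suc k) C suc k + suc k * overflow (suc k) j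
      ≡⟨ cong (_+ suc k * overflow (suc k) j) (nCk+nC[k+1]≡[n+1]C[k+1] (j + suc k) k) ⟩
    (suc j + suc k) C suc k + suc k * overflow (suc k) j ∎
    where
    open ≡-Reasoning
    regroup : ∀ c b s u v → c + b + s * (u + v) ≡ (c + s * v) + b + s * u
    regroup = solve-∀

  module _ (p>0 : 0 < p) where

    count-zero : ∀ k → count k 0 ≡ 1
    count-zero zero    = refl
    count-zero (suc k) = trans (∑<-single p>0 (λ _ → countWith-beyond k)) (count-zero k)

    count-suc-below : ∀ k {n} → n < p → count (suc k) n ≡ (∑[ x < n ] count k (n ∸ x)) + count k 0
    count-suc-below k {n} n<p = begin
      ∑[ x < p ] countWith k x n
        ≡⟨ cong (λ q → ∑[ x < q ] countWith k x n) (sym (m+[n∸m]≡n n<p)) ⟩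
      ∑[ x < suc n + (p ∸ suc n) ] countWith k x n
        ≡⟨ ∑<-split (suc n) (p ∸ suc n) (λ x → countWith k x n) ⟩
      (∑[ x < suc n ] countWith k x n) + (∑[ x < p ∸ suc n ] countWith k (suc n + x) n)
        ≡⟨ cong₂ _+_ (∑<-suc n (λ x → countWith k x n))
                     (trans (∑<-cong (p ∸ suc n) (λ x _ → countWith-beyond k (s≤s (m≤m+n n x)))) (∑<-0 (p ∸ suc n))) ⟩
      (∑[ x < n ] countWith k x n) + countWith k n n + 0
        ≡⟨ +-identityʳ _ ⟩
      (∑[ x < n ] countWith k x n) + countWith k n n
        ≡⟨ cong₂ _+_ (∑<-cong n (λ x x<n → countWith≡count k (<⇒≤ x<n)))
                     (trans (countWith≡count k ≤-refl) (cong (count k) (n∸n≡0 n))) ⟩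
      (∑[ x < n ] count k (n ∸ x)) + count k 0 ∎
      where open ≡-Reasoning

    count-suc-above : ∀ k {n} → p ≤ n → count (suc k) n ≡ ∑[ x < p ] count k (n ∸ x)
    count-suc-above k p≤n = ∑<-cong p (λ x x<p → countWith≡count k (≤-trans (<⇒≤ x<p) p≤n))

    telescope-count : ∀ k → ΔInclusionExclusion k → ∀ {n} → n < p + p → ∀ q → q ≤ n →
      (∑[ x < q ] count k (n ∸ x)) + (n ∸ q + k) C k + k * overflow k n ≡ (n + k) C k + k * overflow k (n ∸ q)
    telescope-count k Δ {n} n<2p =
      telescope (count k) (λ j → (j + k) C k) (λ j → k * overflow k j) n (λ j 1+j≤n → Δ j (≤-<-trans 1+j≤n n<2p))

    inclusion-exclusion-below : ∀ k → ΔInclusionExclusion k → ∀ {n} → n < p →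
      count (suc k) n + suc k * overflow k n ≡ (n + k) C k
    inclusion-exclusion-below k Δ {n} n<p = begin
      count (suc k) n + suc k * overflow k n
        ≡⟨ cong₂ _+_ (count-suc-below k n<p) (cong (suc k *_) (overflow-< k n<p)) ⟩
      S + count k 0 + suc k * 0
        ≡⟨ cong₂ (λ a b → S + a + b) (trans (count-zero k) (sym [0+k]Ck≡1)) (trans (*-zeroʳ (suc k)) (sym k*overflow≡0)) ⟩
      S + (n ∸ n + k) C k + k * overflow k n
        ≡⟨ telescope-count k Δ (<-≤-trans n<p (m≤m+n p p)) n ≤-refl ⟩
      (n + k) C k + k * overflow k (n ∸ n)
        ≡⟨ cong (λ m → (n + k) C k + k * overflow k m) (n∸n≡0 n) ⟩
      (n + k) C k + k * overflow k 0
        ≡⟨ cong (λ m → (n + k) C k + k * m) (overflow-< k p>0) ⟩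
      (n + k) C k + k * 0
        ≡⟨ cong ((n + k) C k +_) (*-zeroʳ k) ⟩
      (n + k) C k + 0
        ≡⟨ +-identityʳ _ ⟩
      (n + k) C k ∎
      where
      open ≡-Reasoning
      S : ℕ
      S = ∑[ x < n ] count k (n ∸ x)
      [0+k]Ck≡1 : (n ∸ n + k) C k ≡ 1
      [0+k]Ck≡1 = trans (cong (λ m → (m + k) C k) (n∸n≡0 n)) (nCn≡1 k)
      k*overflow≡0 : k * overflow k n ≡ 0
      k*overflow≡0 = trans (cong (k *_) (overflow-< k n<p)) (*-zeroʳ k)

    inclusion-exclusion-above : ∀ k → ΔInclusionExclusion k → ∀ {n} → p ≤ n → n < p + p →
      count (suc k) n + suc k * overflow k n ≡ (n + k) C k
    inclusion-exclusion-above k Δ {n} p≤n n<2p = begin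
      count (suc k) n + suc k * overflow k n
        ≡⟨ cong (_+ suc k * overflow k n) (count-suc-above k p≤n) ⟩
      S + (overflow k n + k * overflow k n)
        ≡⟨ +-assoc S (overflow k n) (k * overflow k n) ⟨
      S + overflow k n + k * overflow k n
        ≡⟨ cong (λ m → S + m + k * overflow k n) (overflow-≥ k p≤n) ⟩
      S + (n ∸ p + k) C k + k * overflow k n
        ≡⟨ telescope-count k Δ n<2p p p≤n ⟩
      (n + k) C k + k * overflow k (n ∸ p)
        ≡⟨ cong (λ m → (n + k) C k + k * m) (overflow-< k n∸p<p) ⟩
      (n + k) C k + k * 0
        ≡⟨ cong ((n + k) C k +_) (*-zeroʳ k) ⟩
      (n + k) C k + 0
        ≡⟨ +-identityʳ _ ⟩
      (n + k) C k ∎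
      where
      open ≡-Reasoning
      S : ℕ
      S = ∑[ x < p ] count k (n ∸ x)
      n∸p<p : n ∸ p < p
      n∸p<p = +-cancelʳ-< _ _ p (subst (_< p + p) (sym (m∸n+n≡m p≤n)) n<2p)

    ΔInclusionExclusion-of : ∀ k → ΔInclusionExclusion k

    inclusion-exclusion : ∀ k → InclusionExclusion k
    inclusion-exclusion k n n<2p with n <? p
    ... | yes n<p = inclusion-exclusion-below k (ΔInclusionExclusion-of k) n<p
    ... | no  n≮p = inclusion-exclusion-above k (ΔInclusionExclusion-of k) (≮⇒≥ n≮p) n<2p

    ΔInclusionExclusion-of zero    = ΔInclusionExclusion-zero
    ΔInclusionExclusion-of (suc k) = ΔInclusionExclusion-suc k (inclusion-exclusion k)

2*[m+2]C2≡[m+1][m+2] : ∀ m → 2 * ((m + 2) C 2) ≡ (m + 1) * (m + 2)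
2*[m+2]C2≡[m+1][m+2] zero    = refl
2*[m+2]C2≡[m+1][m+2] (suc m) = begin
  2 * (suc (m + 2) C 2)                     ≡⟨ cong (2 *_) (sym (nCk+nC[k+1]≡[n+1]C[k+1] (m + 2) 1)) ⟩
  2 * ((m + 2) C 1 + (m + 2) C 2)           ≡⟨ *-distribˡ-+ 2 ((m + 2) C 1) ((m + 2) C 2) ⟩
  2 * ((m + 2) C 1) + 2 * ((m + 2) C 2)     ≡⟨ cong₂ _+_ (cong (2 *_) (nC1≡n (m + 2))) (2*[m+2]C2≡[m+1][m+2] m) ⟩
  2 * (m + 2) + (m + 1) * (m + 2)           ≡⟨ polynomial m ⟩
  (suc m + 1) * (suc m + 2)                 ∎
  where
  open ≡-Reasoning
  polynomial : ∀ m → 2 * (m + 2) + (m + 1) * (m + 2) ≡ (suc m + 1) * (suc m + 2)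
  polynomial = solve-∀

6*[m+3]C3≡[m+1][m+2][m+3] : ∀ m → 6 * ((m + 3) C 3) ≡ (m + 1) * (m + 2) * (m + 3)
6*[m+3]C3≡[m+1][m+2][m+3] zero    = refl
6*[m+3]C3≡[m+1][m+2][m+3] (suc m) = begin
  6 * (suc (m + 3) C 3)                     ≡⟨ cong (6 *_) (sym (nCk+nC[k+1]≡[n+1]C[k+1] (m + 3) 2)) ⟩
  6 * ((m + 3) C 2 + (m + 3) C 3)           ≡⟨ *-distribˡ-+ 6 ((m + 3) C 2) ((m + 3) C 3) ⟩
  6 * ((m + 3) C 2) + 6 * ((m + 3) C 3)     ≡⟨ cong₂ _+_ lower (6*[m+3]C3≡[m+1][m+2][m+3] m) ⟩
  3 * ((suc m + 1) * (suc m + 2)) + (m + 1) * (m + 2) * (m + 3)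
                                            ≡⟨ polynomial m ⟩
  (suc m + 1) * (suc m + 2) * (suc m + 3)   ∎
  where
  open ≡-Reasoning
  lower : 6 * ((m + 3) C 2) ≡ 3 * ((suc m + 1) * (suc m + 2))
  lower = trans (cong (λ r → 6 * (r C 2)) (+-suc m 2))
                (trans (*-assoc 3 2 ((suc m + 2) C 2)) (cong (3 *_) (2*[m+2]C2≡[m+1][m+2] (suc m))))
  polynomial : ∀ m → 3 * ((suc m + 1) * (suc m + 2)) + (m + 1) * (m + 2) * (m + 3)
                     ≡ (suc m + 1) * (suc m + 2) * (suc m + 3)
  polynomial = solve-∀

24*[m+4]C4≡[m+1][m+2][m+3][m+4] : ∀ m → 24 * ((m + 4) C 4) ≡ (m + 1) * (m + 2) * (m + 3) * (m + 4)
24*[m+4]C4≡[m+1][m+2][m+3][m+4] zero    = refl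
24*[m+4]C4≡[m+1][m+2][m+3][m+4] (suc m) = begin
  24 * (suc (m + 4) C 4)                    ≡⟨ cong (24 *_) (sym (nCk+nC[k+1]≡[n+1]C[k+1] (m + 4) 3)) ⟩
  24 * ((m + 4) C 3 + (m + 4) C 4)          ≡⟨ *-distribˡ-+ 24 ((m + 4) C 3) ((m + 4) C 4) ⟩
  24 * ((m + 4) C 3) + 24 * ((m + 4) C 4)   ≡⟨ cong₂ _+_ lower (24*[m+4]C4≡[m+1][m+2][m+3][m+4] m) ⟩
  4 * ((suc m + 1) * (suc m + 2) * (suc m + 3)) + (m + 1) * (m + 2) * (m + 3) * (m + 4)
                                            ≡⟨ polynomial m ⟩
  (suc m + 1) * (suc m + 2) * (suc m + 3) * (suc m + 4) ∎
  where
  open ≡-Reasoning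
  lower : 24 * ((m + 4) C 3) ≡ 4 * ((suc m + 1) * (suc m + 2) * (suc m + 3))
  lower = trans (cong (λ r → 24 * (r C 3)) (+-suc m 3))
                (trans (*-assoc 4 6 ((suc m + 3) C 3)) (cong (4 *_) (6*[m+3]C3≡[m+1][m+2][m+3] (suc m))))
  polynomial : ∀ m → 4 * ((suc m + 1) * (suc m + 2) * (suc m + 3)) + (m + 1) * (m + 2) * (m + 3) * (m + 4)
                     ≡ (suc m + 1) * (suc m + 2) * (suc m + 3) * (suc m + 4)
  polynomial = solve-∀

-- Integer and rational arithmetic

open import Data.Integer as ℤ using (ℤ; +_)
import Data.Integer.Properties as ℤ
import Data.Integer.Tactic.RingSolver as ℤ-Solver
open import Data.Rational as ℚ using (ℚ; _/_; -_; toℚᵘ)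
import Data.Rational.Properties as ℚ
open import Data.Rational.Unnormalised as ℚᵘ using (mkℚᵘ; *≡*)
import Data.Rational.Unnormalised.Properties as ℚᵘ

rising4 : ℤ → ℤ
rising4 x = (x ℤ.+ + 1) ℤ.* (x ℤ.+ + 2) ℤ.* (x ℤ.+ + 3) ℤ.* (x ℤ.+ + 4)

24*[m+4]C4≡rising4 : ∀ m → + 24 ℤ.* + ((m + 4) C 4) ≡ rising4 (+ m)
24*[m+4]C4≡rising4 m = begin
  + 24 ℤ.* + ((m + 4) C 4)                                     ≡⟨ ℤ.pos-* 24 ((m + 4) C 4) ⟨
  + (24 * ((m + 4) C 4))                                        ≡⟨ cong +_ (24*[m+4]C4≡[m+1][m+2][m+3][m+4] m) ⟩
  + ((m + 1) * (m + 2) * (m + 3) * (m + 4))                     ≡⟨ cast ⟩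
  rising4 (+ m)                                                 ∎
  where
  open ≡-Reasoning
  cast : + ((m + 1) * (m + 2) * (m + 3) * (m + 4)) ≡ rising4 (+ m)
  cast = trans (ℤ.pos-* ((m + 1) * (m + 2) * (m + 3)) (m + 4)) (cong₂ ℤ._*_
           (trans (ℤ.pos-* ((m + 1) * (m + 2)) (m + 3)) (cong₂ ℤ._*_
             (trans (ℤ.pos-* (m + 1) (m + 2)) (cong₂ ℤ._*_ (ℤ.pos-+ m 1) (ℤ.pos-+ m 2)))
             (ℤ.pos-+ m 3)))
           (ℤ.pos-+ m 4))

module _ {p : ℕ} (p-prime : Prime p) (p>5 : 5 < p) where

  ∤-≤5 : ∀ m .{{_ : ℕ.NonZero m}} → m ≤ 5 → ¬ p ∣ m
  ∤-≤5 m m≤5 p∣m = <⇒≱ p>5 (≤-trans (∣⇒≤ p∣m) m≤5)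

  ∤24 : ¬ p ∣ 24
  ∤24 p∣24 = [ ∤-≤5 4 (s≤s (s≤s (s≤s (s≤s z≤n)))) , ∤6 ]′ (euclidsLemma 4 6 p-prime p∣24)
    where
    ∤6 : ¬ p ∣ 6
    ∤6 p∣6 = [ ∤-≤5 2 (s≤s (s≤s z≤n)) , ∤-≤5 3 (s≤s (s≤s (s≤s z≤n))) ]′ (euclidsLemma 2 3 p-prime p∣6)

  ∣24*⇒∣ : ∀ m → p ∣ 24 * m → p ∣ m
  ∣24*⇒∣ m p∣24m = [ (λ p∣24 → contradiction p∣24 ∤24) , id ]′ (euclidsLemma 24 m p-prime p∣24m)

  coprime-denominator-/24 : ∀ z → Coprime (ℚ.denominatorℕ (z / 24)) p
  coprime-denominator-/24 z {d} (d∣den , d∣p) with prime⇒irreducible p-prime d∣p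
  ... | inj₁ d≡1 = d≡1
  ... | inj₂ d≡p = contradiction (subst (_∣ 24) d≡p (∣-trans d∣den den∣24)) ∤24
    where
    den∣24 : ℚ.denominatorℕ (z / 24) ∣ 24
    den∣24 = divides (gcd ℤ.∣ z ∣ 24) (trans
      (sym (ℤ.+-injective (trans (ℤ.pos-* (ℚ.denominatorℕ (z / 24)) (gcd ℤ.∣ z ∣ 24)) (ℚ.↧-/ z 24))))
      (*-comm (ℚ.denominatorℕ (z / 24)) (gcd ℤ.∣ z ∣ 24)))

  module _ (c : ℕ) (s z : ℤ) (24c≡ : + 24 ℤ.* + c ≡ + 6 ℤ.* s ℤ.* + p ℤ.+ + p ℤ.* + p ℤ.* z) where

    quartic-divisible : p ∣ c
    quartic-divisible = ∣24*⇒∣ c (divides ℤ.∣ w ∣ (begin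
      24 * c                  ≡⟨ ℤ.abs-* (+ 24) (+ c) ⟨
      ℤ.∣ + 24 ℤ.* + c ∣      ≡⟨ cong ℤ.∣_∣ (trans 24c≡ (factor s z (+ p))) ⟩
      ℤ.∣ + p ℤ.* w ∣         ≡⟨ ℤ.abs-* (+ p) w ⟩
      p * ℤ.∣ w ∣             ≡⟨ *-comm p ℤ.∣ w ∣ ⟩
      ℤ.∣ w ∣ * p             ∎))
      where
      open ≡-Reasoning
      w : ℤ
      w = + 6 ℤ.* s ℤ.+ + p ℤ.* z
      factor : ∀ s z P → + 6 ℤ.* s ℤ.* P ℤ.+ P ℤ.* P ℤ.* z ≡ P ℤ.* (+ 6 ℤ.* s ℤ.+ P ℤ.* z)
      factor = ℤ-Solver.solve-∀

    -- The witness z / 24 has a denominator dividing 24, hence prime to p.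
    quartic-congruence : CongModPow p 2 (ℕ→ℚ c) ((s / 4) ℚ.* ℕ→ℚ p)
    quartic-congruence = z / 24 , coprime-denominator-/24 z , ℚ.toℚᵘ-injective
      (ℚᵘ.≃-trans lhs (ℚᵘ.≃-trans (*≡* cross) (ℚᵘ.≃-sym rhs)))
      where
      toℚᵘ-ℕ→ℚ : ∀ n → toℚᵘ (ℕ→ℚ n) ℚᵘ.≃ mkℚᵘ (+ n) 0
      toℚᵘ-ℕ→ℚ n = ℚ.toℚᵘ-fromℚᵘ (mkℚᵘ (+ n) 0)
      lhs : toℚᵘ (ℕ→ℚ c ℚ.- (s / 4) ℚ.* ℕ→ℚ p) ℚᵘ.≃ mkℚᵘ (+ c) 0 ℚᵘ.+ ℚᵘ.- (mkℚᵘ s 3 ℚᵘ.* mkℚᵘ (+ p) 0)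
      lhs = ℚᵘ.≃-trans (ℚ.toℚᵘ-homo-+ (ℕ→ℚ c) (ℚ.- ((s / 4) ℚ.* ℕ→ℚ p)))
        (ℚᵘ.+-cong (toℚᵘ-ℕ→ℚ c) (ℚᵘ.≃-trans (ℚ.toℚᵘ-homo‿- ((s / 4) ℚ.* ℕ→ℚ p))
          (ℚᵘ.-‿cong (ℚᵘ.≃-trans (ℚ.toℚᵘ-homo-* (s / 4) (ℕ→ℚ p))
            (ℚᵘ.*-cong (ℚ.toℚᵘ-fromℚᵘ (mkℚᵘ s 3)) (toℚᵘ-ℕ→ℚ p))))))
      rhs : toℚᵘ (ℕ→ℚ (p ^ 2) ℚ.* (z / 24)) ℚᵘ.≃ mkℚᵘ (+ (p ^ 2)) 0 ℚᵘ.* mkℚᵘ z 23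
      rhs = ℚᵘ.≃-trans (ℚ.toℚᵘ-homo-* (ℕ→ℚ (p ^ 2)) (z / 24))
        (ℚᵘ.*-cong (toℚᵘ-ℕ→ℚ (p ^ 2)) (ℚ.toℚᵘ-fromℚᵘ (mkℚᵘ z 23)))
      cross : (+ c ℤ.* + 4 ℤ.+ (ℤ.- (s ℤ.* + p)) ℤ.* + 1) ℤ.* + 24 ≡ (+ (p ^ 2) ℤ.* z) ℤ.* + 4
      cross = begin
        (+ c ℤ.* + 4 ℤ.+ (ℤ.- (s ℤ.* + p)) ℤ.* + 1) ℤ.* + 24     ≡⟨ expand₁ (+ c) s (+ p) ⟩
        + 4 ℤ.* (+ 24 ℤ.* + c) ℤ.- + 24 ℤ.* s ℤ.* + p              ≡⟨ cong (λ x → + 4 ℤ.* x ℤ.- + 24 ℤ.* s ℤ.* + p) 24c≡ ⟩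
        + 4 ℤ.* (+ 6 ℤ.* s ℤ.* + p ℤ.+ + p ℤ.* + p ℤ.* z) ℤ.- + 24 ℤ.* s ℤ.* + p
                                                                    ≡⟨ expand₂ s z (+ p) ⟩
        (+ p ℤ.* + p ℤ.* z) ℤ.* + 4                                ≡⟨ cong (λ x → (x ℤ.* z) ℤ.* + 4) p*p≡p^2 ⟩
        (+ (p ^ 2) ℤ.* z) ℤ.* + 4                                  ∎
        where
        open ≡-Reasoning
        expand₁ : ∀ c s P → (c ℤ.* + 4 ℤ.+ (ℤ.- (s ℤ.* P)) ℤ.* + 1) ℤ.* + 24
                            ≡ + 4 ℤ.* (+ 24 ℤ.* c) ℤ.- + 24 ℤ.* s ℤ.* P
        expand₁ = ℤ-Solver.solve-∀
        expand₂ : ∀ s z P → + 4 ℤ.* (+ 6 ℤ.* s ℤ.* P ℤ.+ P ℤ.* P ℤ.* z) ℤ.- + 24 ℤ.* s ℤ.* P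
                            ≡ (P ℤ.* P ℤ.* z) ℤ.* + 4
        expand₂ = ℤ-Solver.solve-∀
        p*p≡p^2 : + p ℤ.* + p ≡ + (p ^ 2)
        p*p≡p^2 = trans (cong (+ p ℤ.*_) (sym (cong +_ (*-identityʳ p)))) (sym (ℤ.pos-* p (p * 1)))

+[m∸n]≡+m-+n : ∀ {m n} → n ≤ m → + (m ∸ n) ≡ + m ℤ.- + n
+[m∸n]≡+m-+n {m} {n} n≤m = trans (sym (ℤ.⊖-≥ n≤m)) (sym (ℤ.m-n≡m⊖n m n))

module _ {p : ℕ} (p>0 : 0 < p) {a : ℕ} (1≤a : 1 ≤ a) (a≤p : a ≤ p) where

  private
    n : ℕ
    n = 2 * p ∸ a
    2p≡p+p : 2 * p ≡ p + p
    2p≡p+p = cong (λ m → p + m) (+-identityʳ p)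
    a≤2p : a ≤ 2 * p
    a≤2p = ≤-trans a≤p (m≤n*m p 2)

  count-2p∸a : count p 5 n + 5 * ((p ∸ a + 4) C 4) ≡ (n + 4) C 4
  count-2p∸a = begin
    count p 5 n + 5 * ((p ∸ a + 4) C 4)     ≡⟨ cong (λ m → count p 5 n + 5 * ((m + 4) C 4)) n∸p≡p∸a ⟨
    count p 5 n + 5 * ((n ∸ p + 4) C 4)     ≡⟨ cong (λ m → count p 5 n + 5 * m) (overflow-≥ p 4 p≤n) ⟨
    count p 5 n + 5 * overflow p 4 n        ≡⟨ inclusion-exclusion p p>0 4 n n<p+p ⟩
    (n + 4) C 4                             ∎
    where
    open ≡-Reasoning
    n≡p+[p∸a] : n ≡ p + (p ∸ a)
    n≡p+[p∸a] = trans (cong (_∸ a) 2p≡p+p) (+-∸-assoc p a≤p)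
    n∸p≡p∸a : n ∸ p ≡ p ∸ a
    n∸p≡p∸a = trans (cong (_∸ p) n≡p+[p∸a]) (m+n∸m≡n p (p ∸ a))
    p≤n : p ≤ n
    p≤n = subst (p ≤_) (sym n≡p+[p∸a]) (m≤m+n p (p ∸ a))
    n<p+p : n < p + p
    n<p+p = subst (n <_) 2p≡p+p (∸-monoʳ-< 1≤a a≤2p)

  +count-2p∸a : + count p 5 n ≡ + ((n + 4) C 4) ℤ.- + 5 ℤ.* + ((p ∸ a + 4) C 4)
  +count-2p∸a = begin
    + c                                       ≡⟨ add-sub (+ c) (+ 5 ℤ.* + K) ⟩
    + c ℤ.+ + 5 ℤ.* + K ℤ.- + 5 ℤ.* + K       ≡⟨ cong (λ x → + c ℤ.+ x ℤ.- + 5 ℤ.* + K) (ℤ.pos-* 5 K) ⟨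
    + c ℤ.+ + (5 * K) ℤ.- + 5 ℤ.* + K         ≡⟨ cong (ℤ._- + 5 ℤ.* + K) (ℤ.pos-+ c (5 * K)) ⟨
    + (c + 5 * K) ℤ.- + 5 ℤ.* + K             ≡⟨ cong (λ m → + m ℤ.- + 5 ℤ.* + K) count-2p∸a ⟩
    + ((n + 4) C 4) ℤ.- + 5 ℤ.* + K           ∎
    where
    open ≡-Reasoning
    c K : ℕ
    c = count p 5 n
    K = (p ∸ a + 4) C 4
    add-sub : ∀ x y → x ≡ x ℤ.+ y ℤ.- y
    add-sub = ℤ-Solver.solve-∀

  24*count-2p∸a : + 24 ℤ.* + count p 5 n ≡ rising4 (+ 2 ℤ.* + p ℤ.- + a) ℤ.- + 5 ℤ.* rising4 (+ p ℤ.- + a)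
  24*count-2p∸a = begin
    + 24 ℤ.* + count p 5 n                                   ≡⟨ cong (+ 24 ℤ.*_) +count-2p∸a ⟩
    + 24 ℤ.* (+ L ℤ.- + 5 ℤ.* + K)                           ≡⟨ distribute (+ L) (+ K) ⟩
    + 24 ℤ.* + L ℤ.- + 5 ℤ.* (+ 24 ℤ.* + K)                  ≡⟨ cong₂ (λ x y → x ℤ.- + 5 ℤ.* y)
                                                                  (24*[m+4]C4≡rising4 n) (24*[m+4]C4≡rising4 (p ∸ a)) ⟩
    rising4 (+ n) ℤ.- + 5 ℤ.* rising4 (+ (p ∸ a))           ≡⟨ cong₂ (λ x y → rising4 x ℤ.- + 5 ℤ.* rising4 y)
                                                                  +n≡ (+[m∸n]≡+m-+n a≤p) ⟩
    rising4 (+ 2 ℤ.* + p ℤ.- + a) ℤ.- + 5 ℤ.* rising4 (+ p ℤ.- + a) ∎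
    where
    open ≡-Reasoning
    L K : ℕ
    L = (n + 4) C 4
    K = (p ∸ a + 4) C 4
    distribute : ∀ x y → + 24 ℤ.* (x ℤ.- + 5 ℤ.* y) ≡ + 24 ℤ.* x ℤ.- + 5 ℤ.* (+ 24 ℤ.* y)
    distribute = ℤ-Solver.solve-∀
    +n≡ : + n ≡ + 2 ℤ.* + p ℤ.- + a
    +n≡ = trans (+[m∸n]≡+m-+n a≤2p) (cong (ℤ._- + a) (ℤ.pos-* 2 p))

-- slope (+ 1), …, slope (+ 4) evaluate to −3, 1, −1, 3, four times the constants of the congruences.
slope : ℤ → ℤ
slope A = + 2 ℤ.* A ℤ.* A ℤ.* A ℤ.- + 15 ℤ.* A ℤ.* A ℤ.+ + 35 ℤ.* A ℤ.- + 25

remainder : ℤ → ℤ → ℤ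
remainder A P = + 11 ℤ.* P ℤ.* P ℤ.+ (+ 30 ℤ.- + 12 ℤ.* A) ℤ.* P ℤ.- (+ 6 ℤ.* A ℤ.* A ℤ.- + 30 ℤ.* A ℤ.+ + 35)

-- Taylor expansion in P; the constant term −4 · rising4 (− A) vanishes exactly for A ∈ {1, 2, 3, 4}.
rising4-expansion : ∀ A P → rising4 (+ 2 ℤ.* P ℤ.- A) ℤ.- + 5 ℤ.* rising4 (P ℤ.- A)
  ≡ + 6 ℤ.* slope A ℤ.* P ℤ.+ P ℤ.* P ℤ.* remainder A P ℤ.- + 4 ℤ.* rising4 (ℤ.- A)
rising4-expansion = unfolded
  where
  -- Spelled out because the ring solver does not unfold definitions.
  unfolded : ∀ A P → let X = + 2 ℤ.* P ℤ.- A ; Y = P ℤ.- A ; Z = ℤ.- A in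
    (X ℤ.+ + 1) ℤ.* (X ℤ.+ + 2) ℤ.* (X ℤ.+ + 3) ℤ.* (X ℤ.+ + 4)
      ℤ.- + 5 ℤ.* ((Y ℤ.+ + 1) ℤ.* (Y ℤ.+ + 2) ℤ.* (Y ℤ.+ + 3) ℤ.* (Y ℤ.+ + 4))
    ≡ + 6 ℤ.* (+ 2 ℤ.* A ℤ.* A ℤ.* A ℤ.- + 15 ℤ.* A ℤ.* A ℤ.+ + 35 ℤ.* A ℤ.- + 25) ℤ.* P
      ℤ.+ P ℤ.* P ℤ.* (+ 11 ℤ.* P ℤ.* P ℤ.+ (+ 30 ℤ.- + 12 ℤ.* A) ℤ.* P ℤ.- (+ 6 ℤ.* A ℤ.* A ℤ.- + 30 ℤ.* A ℤ.+ + 35))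
      ℤ.- + 4 ℤ.* ((Z ℤ.+ + 1) ℤ.* (Z ℤ.+ + 2) ℤ.* (Z ℤ.+ + 3) ℤ.* (Z ℤ.+ + 4))
  unfolded = ℤ-Solver.solve-∀

rising4-root : ∀ {a} → 1 ≤ a → a ≤ 4 → rising4 (ℤ.- + a) ≡ + 0
rising4-root {1} _ _ = refl
rising4-root {2} _ _ = refl
rising4-root {3} _ _ = refl
rising4-root {4} _ _ = refl
rising4-root {suc (suc (suc (suc (suc _))))} _ (s≤s (s≤s (s≤s (s≤s ()))))

module _ {p : ℕ} (p-prime : Prime p) (p>5 : 5 < p) (a : ℕ) (1≤a : 1 ≤ a) (a≤4 : a ≤ 4) where

  private
    n : ℕ
    n = 2 * p ∸ a
    p>0 : 0 < p
    p>0 = <-trans (s≤s z≤n) p>5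
    a≤p : a ≤ p
    a≤p = ≤-trans a≤4 (<⇒≤ (<-trans (n<1+n 4) p>5))

  24*count-2p∸a≡quartic : + 24 ℤ.* + count p 5 n ≡ + 6 ℤ.* slope (+ a) ℤ.* + p ℤ.+ + p ℤ.* + p ℤ.* remainder (+ a) (+ p)
  24*count-2p∸a≡quartic = begin
    + 24 ℤ.* + count p 5 n                                ≡⟨ 24*count-2p∸a p>0 1≤a a≤p ⟩
    rising4 (+ 2 ℤ.* + p ℤ.- + a) ℤ.- + 5 ℤ.* rising4 (+ p ℤ.- + a)
                                                          ≡⟨ rising4-expansion (+ a) (+ p) ⟩
    E ℤ.- + 4 ℤ.* rising4 (ℤ.- + a)                       ≡⟨ cong (λ x → E ℤ.- + 4 ℤ.* x) (rising4-root 1≤a a≤4) ⟩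
    E ℤ.- + 4 ℤ.* + 0                                     ≡⟨ ℤ.+-identityʳ E ⟩
    E                                                     ∎
    where
    open ≡-Reasoning
    E : ℤ
    E = + 6 ℤ.* slope (+ a) ℤ.* + p ℤ.+ + p ℤ.* + p ℤ.* remainder (+ a) (+ p)

  length-tuples5 : + length (tuples5 p n) ≡ + ((n + 4) C 4) ℤ.- + 5 ℤ.* + ((p ∸ a + 4) C 4)
  length-tuples5 = trans (cong +_ (length-tuplesWith p 5 0 n)) (+count-2p∸a p>0 1≤a a≤p)

  length-tuples5-congruence : CongModPow p 2 (ℕ→ℚ (length (tuples5 p n))) ((slope (+ a) / 4) ℚ.* ℕ→ℚ p)
  length-tuples5-congruence = subst (λ c → CongModPow p 2 (ℕ→ℚ c) ((slope (+ a) / 4) ℚ.* ℕ→ℚ p))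
    (sym (length-tuplesWith p 5 0 n))
    (quartic-congruence p-prime p>5 (count p 5 n) (slope (+ a)) (remainder (+ a) (+ p)) 24*count-2p∸a≡quartic)

  sum-head-tuples5-divisible : p ∣ sum (map head (tuples5 p n))
  sum-head-tuples5-divisible = subst (p ∣_) (sym (sum-head-tuplesWith p 4 0 n))
    ([ (λ p∣5 → contradiction p∣5 (∤-≤5 p-prime p>5 5 ≤-refl)) , id ]′ (euclidsLemma 5 _ p-prime p∣5*firstSum))
    where
    p∣count : p ∣ count p 5 n
    p∣count = quartic-divisible p-prime p>5 (count p 5 n) (slope (+ a)) (remainder (+ a) (+ p)) 24*count-2p∸a≡quartic
    p∣5*firstSum : p ∣ 5 * firstSumWith p 5 0 n
    p∣5*firstSum = subst (p ∣_) (∸-*-countWith p 5 0 n) (∣n⇒∣m*n n p∣count)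

lemma2p2 : ∀ (p : ℕ) → Prime p → 5 < p →
  (∀ (a : ℕ) → 1 ≤ a → a ≤ 4 →
     (+ length (tuples5 p (2 * p ∸ a))
        ≡ (+ ((2 * p ∸ a + 4) C 4)) ℤ.- (+ 5) ℤ.* (+ ((p ∸ a + 4) C 4)))
     × (p ∣ sum (map head (tuples5 p (2 * p ∸ a)))))
  × CongModPow p 2 (ℕ→ℚ (length (tuples5 p (2 * p ∸ 1)))) ((- (+ 3 / 4)) ℚ.* ℕ→ℚ p)
  × CongModPow p 2 (ℕ→ℚ (length (tuples5 p (2 * p ∸ 2)))) ((+ 1 / 4) ℚ.* ℕ→ℚ p)
  × CongModPow p 2 (ℕ→ℚ (length (tuples5 p (2 * p ∸ 3)))) ((- (+ 1 / 4)) ℚ.* ℕ→ℚ p)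
  × CongModPow p 2 (ℕ→ℚ (length (tuples5 p (2 * p ∸ 4)))) ((+ 3 / 4) ℚ.* ℕ→ℚ p)
lemma2p2 p p-prime p>5 =
  (λ a 1≤a a≤4 → length-tuples5 p-prime p>5 a 1≤a a≤4 , sum-head-tuples5-divisible p-prime p>5 a 1≤a a≤4)
  , length-tuples5-congruence p-prime p>5 1 (s≤s z≤n) (s≤s z≤n)
  , length-tuples5-congruence p-prime p>5 2 (s≤s z≤n) (s≤s (s≤s z≤n))
  , length-tuples5-congruence p-prime p>5 3 (s≤s z≤n) (s≤s (s≤s (s≤s z≤n)))
  , length-tuples5-congruence p-prime p>5 4 (s≤s z≤n) ≤-refl
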